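{- Let $\mathbf G$ be a finite abelian group, let $k>m\ge1$ be integers, and let $B\subseteq\mathbf G$ satisfy $B^k+\Delta(B)=\mathbf G^k$. Then $B^m-\Delta(B)=\mathbf G^m$ (i.e. $B$ is a basis of depth $m$).
   Context: For $n\ge1$, $B^n\pm\Delta(B)=\{(b_1\pm b,\dots,b_n\pm b): b_1,\dots,b_n,b\in B\}\subseteq\mathbf G^n$. -}

module Defs where

open import Level using (Level; _⊔_; suc)
open import Algebra.Bundles using (AbelianGroup)
open import Data.Nat using (ℕ)
open import Data.Fin using (Fin)
open import Data.List using (List)
open import Data.List.Relation.Unary.Any using (Any)
open import Data.Product using (Σ; _×_; ∃)

module _ {c ℓ : Level} (G : AbelianGroup c ℓ) where
  open AbelianGroup G

  IsFinite : Set (c ⊔ ℓ)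
  IsFinite = Σ (List Carrier) λ xs → ∀ x → Any (x ≈_) xs

  record Subset (p : Level) : Set (c ⊔ ℓ ⊔ suc p) where
    field
      _∈_     : Carrier → Set p
      respects : ∀ {x y} → x ≈ y → _∈_ x → _∈_ y
  open Subset public

  -- g ∈ B^n + Δ(B): g = (b₁ + b, …, bₙ + b) with b₁,…,bₙ,b ∈ B.
  InSumDiag : ∀ {p} (B : Subset p) (n : ℕ) → (Fin n → Carrier) → Set (c ⊔ ℓ ⊔ p)
  InSumDiag B n g =
    Σ (Fin n → Carrier) λ bs → Σ Carrier λ b →
      (∀ i → _∈_ B (bs i)) × _∈_ B b × (∀ i → g i ≈ bs i ∙ b)

  -- g ∈ B^n − Δ(B): g = (b₁ − b, …, bₙ − b) with b₁,…,bₙ,b ∈ B.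
  InDiffDiag : ∀ {p} (B : Subset p) (n : ℕ) → (Fin n → Carrier) → Set (c ⊔ ℓ ⊔ p)
  InDiffDiag B n g =
    Σ (Fin n → Carrier) λ bs → Σ Carrier λ b →
      (∀ i → _∈_ B (bs i)) × _∈_ B b × (∀ i → g i ≈ bs i ∙ (b ⁻¹))

  SumDiagCovers : ∀ {p} (B : Subset p) (n : ℕ) → Set (c ⊔ ℓ ⊔ p)
  SumDiagCovers B n = ∀ (g : Fin n → Carrier) → InSumDiag B n g

  DiffDiagCovers : ∀ {p} (B : Subset p) (n : ℕ) → Set (c ⊔ ℓ ⊔ p)
  DiffDiagCovers B n = ∀ (g : Fin n → Carrier) → InDiffDiag B n g

module Submission where

-- Appending a coordinate to a covering problem turns sums into
-- differences: if  B^(n+1) + Δ(B) = G^(n+1),  write the vector (ε, g₁, …, gₙ)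
-- as (b₀ + b, b₁ + b, …, bₙ + b).  The first coordinate forces b ≈ b₀⁻¹, so
-- gᵢ ≈ bᵢ − b₀, i.e.  B^n − Δ(B) = G^n  (lemma sumCovers⇒diffCovers).

open import Defs
open import Level using (Level)
open import Algebra.Bundles using (AbelianGroup)
open import Data.Nat using (ℕ; suc; _<_; _≤_; _≤′_; ≤′-refl; ≤′-step)
open import Data.Nat.Properties using (≤⇒≤′)
open import Data.Fin using (Fin; zero) renaming (suc to fsuc)
open import Data.Vec.Functional using (_∷_)
open import Data.Product using (_,_)
import Algebra.Properties.Group as GroupProperties

module _ {c ℓ p : Level} (G : AbelianGroup c ℓ) (B : Subset G p) where
  open AbelianGroup G
  open GroupProperties group using (inverseʳ-unique)

  sumCovers-drop : ∀ {n} → SumDiagCovers G B (suc n) → SumDiagCovers G B n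
  sumCovers-drop cover g with cover (ε ∷ g)
  ... | bs , b , bs∈B , b∈B , eq =
    (λ i → bs (fsuc i)) , b , (λ i → bs∈B (fsuc i)) , b∈B , (λ i → eq (fsuc i))

  sumCovers-mono : ∀ {n k} → n ≤′ k → SumDiagCovers G B k → SumDiagCovers G B n
  sumCovers-mono ≤′-refl        cover = cover
  sumCovers-mono (≤′-step n≤′k) cover = sumCovers-mono n≤′k (sumCovers-drop cover)

  sumCovers⇒diffCovers : ∀ {n} → SumDiagCovers G B (suc n) → DiffDiagCovers G B n
  sumCovers⇒diffCovers cover g with cover (ε ∷ g)
  ... | bs , b , bs∈B , b∈B , eq =
    (λ i → bs (fsuc i)) , bs zero , (λ i → bs∈B (fsuc i)) , bs∈B zero ,
    (λ i → trans (eq (fsuc i)) (∙-congˡ b≈b₀⁻¹))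
    where
    b≈b₀⁻¹ : b ≈ bs zero ⁻¹
    b≈b₀⁻¹ = inverseʳ-unique (bs zero) b (sym (eq zero))

corollary17 : ∀ {c ℓ p : Level} (G : AbelianGroup c ℓ) → IsFinite G →
    (k m : ℕ) → 1 ≤ m → m < k → (B : Subset G p) →
    SumDiagCovers G B k → DiffDiagCovers G B m
corollary17 G _ k m _ m<k B cover =
  sumCovers⇒diffCovers G B (sumCovers-mono G B (≤⇒≤′ m<k) cover)
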